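{- Let $\mathcal{K}=(S,AP,\mathcal{L},\to)$ be a weighted Kripke structure with no 0-cycles. Let $s,s'\in S$ and $w$ be such that $s\to_w s'$, and let $t\in S$. Then there exists $N$ such that for every transition sequence $\pi=t\to_{v_1}t_1\cdots\to_{v_n}t_n$ with $n\ge N$ there exists a transition sequence $\pi^*=t\to_{u_1}t_1'\cdots\to_{u_m}t_m'$ with $m\le N$ such that $t_n=t_m'$, $\ \Big|\frac{\sum_{i=1}^m u_i}{w}-1\Big|\le\Big|\frac{\sum_{i=1}^n v_i}{w}-1\Big|$, and $\{t_1',\ldots,t_{m-1}'\}\subseteq\{t_1,\ldots,t_{n-1}\}$.
   Context: A weighted Kripke structure (WKS) is a tuple $\mathcal{K}=(S,AP,\mathcal{L},\to)$ where $S$ is a finite set of states, $AP$ a set of atomic propositions, $\mathcal{L}:S\to\mathcal{P}(AP)$ a labelling function, and $\to\subseteq S\times\mathbb{Q}_{\ge 0}\times S$ a finite transition relation; we write $s\to_w s'$ for $(s,w,s')\in\to$. A transition sequence from $t$ of length $n$ is $t=t_0\to_{v_1}t_1\cdots\to_{v_n}t_n$ with accumulated weight $\sum_{i=1}^n v_i$. A 0-cycle is a cycle (a nonempty transition sequence whose last state equals its first state) with accumulated weight $0$; "$\mathcal{K}$ has no 0-cycles" means every cycle has strictly positive accumulated weight. -}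

module Defs where

open import Data.Nat using (ℕ; zero; suc)
open import Data.Fin using (Fin)
open import Data.Bool using (Bool)
open import Data.List using (List; []; _∷_)
open import Data.List.Relation.Unary.All using (All)
open import Data.List.Membership.Propositional using (_∈_)
open import Data.Product using (_×_; _,_; proj₁; proj₂)
open import Data.Rational using (ℚ; 0ℚ; _+_; _≤_; _<_)

record WKS : Set₁ where
  field
    k      : ℕ
    AP     : Set
    L      : Fin k → AP → Bool
    trans  : List (Fin k × ℚ × Fin k)
    nonneg : All (λ e → 0ℚ ≤ proj₁ (proj₂ e)) trans

module _ (K : WKS) where
  open WKS K

  data Path : Fin k → Fin k → ℕ → Set where
    done : ∀ {t} → Path t t 0
    step : ∀ {t t₁ u n} (v : ℚ) → (t , v , t₁) ∈ trans →
           Path t₁ u n → Path t u (suc n)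

  weight : ∀ {t u n} → Path t u n → ℚ
  weight done = 0ℚ
  weight (step v _ p) = v + weight p

  -- the intermediate states t₁ , … , t_{n-1}
  inner : ∀ {t u n} → Path t u n → List (Fin k)
  inner done = []
  inner (step _ _ done) = []
  inner (step {t₁ = t₁} _ _ p@(step _ _ _)) = t₁ ∷ inner p

  NoZeroCycles : Set
  NoZeroCycles = ∀ {s n} (π : Path s s (suc n)) → 0ℚ < weight π

-- Let δ > 0 bound all positive transition weights from below. Erasing loops turns any path
-- into a simple one (fewer than k = |S| steps) that is no heavier, visits no new states, and
-- is strictly lighter as soon as it is shorter; without 0-cycles, every path of k or more
-- steps therefore weighs at least δ. Choose q with w ≤ qδ and N = qk + k. A path of length
-- at least N keeps its first qk steps, which already weigh at least w, and has the rest
-- loop-erased: the result is shorter than N, and its weight lies between w and that of the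
-- original path, where x ↦ |x/w − 1| is monotone.
module Submission where

open import Defs
open import Data.Nat using (ℕ)
open import Data.Fin using (Fin)
open import Data.List.Membership.Propositional using (_∈_)
open import Data.Product using (_×_; _,_; Σ; ∃; ∃-syntax)
open import Data.Rational using (ℚ; NonZero; _÷_; _-_; ∣_∣; _≤_; 1ℚ)
import Data.Nat as Nat

open import Data.Nat using (zero; suc; s≤s; z≤n)
import Data.Nat.Properties as Natₚ
open import Data.Nat.Coprimality using (Coprime)
open import Data.Fin using (zero; suc)
import Data.Fin.Properties as Finₚ
open import Data.Integer as ℤ using (+_; +[1+_]; -[1+_]; +≤+; -≤+)
import Data.Integer.Properties as ℤₚ
open import Data.Integer.Solver using (module +-*-Solver)
open import Data.Rational using (mkℚ; 0ℚ; _+_; -_; _<_; *≤*; *<*; NonNegative; 1/_; toℚᵘ; +-0-rawMonoid)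
open import Data.Rational.Properties
import Data.Rational.Unnormalised as ℚᵘ
import Data.Rational.Unnormalised.Properties as ℚᵘₚ
open import Algebra.Definitions.RawMonoid +-0-rawMonoid using () renaming (_×_ to _·_)
open import Data.List using (List; []; _∷_; map; length; lookup)
open import Data.List.Membership.Propositional.Properties using (∈-map⁺; ∈-lookup)
open import Data.List.Relation.Unary.Any using (here; there)
import Data.List.Relation.Unary.All as All
open import Data.List.Relation.Unary.All.Properties using (¬Any⇒All¬)
open import Data.List.Relation.Unary.AllPairs using ([]; _∷_)
open import Data.List.Relation.Unary.Unique.Propositional using (Unique)
open import Data.List.Relation.Unary.Unique.Propositional.Properties using (Unique[x∷xs]⇒x∉xs)
open import Data.List.Relation.Binary.Subset.Propositional using (_⊆_)
open import Data.Product using (proj₁; proj₂)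
open import Data.Sum using (inj₁; inj₂)
open import Function using (_∘_)
open import Relation.Nullary using (yes; no; contradiction)
open import Relation.Binary.PropositionalEquality using (_≡_; refl; sym; trans; cong; subst)

toℚᵘ-· : ∀ q n d .(c : Coprime ℤ.∣ n ∣ (suc d)) → toℚᵘ (q · mkℚ n d c) ℚᵘ.≃ ℚᵘ.mkℚᵘ (+ q ℤ.* n) d
toℚᵘ-· zero n d c = ℚᵘ.*≡* refl
toℚᵘ-· (suc q) n d c = ℚᵘₚ.≃-trans (toℚᵘ-homo-+ x (q · x))
  (ℚᵘₚ.≃-trans (ℚᵘₚ.+-congʳ (toℚᵘ x) (toℚᵘ-· q n d c)) (ℚᵘ.*≡* sum-same-denominator))
  where
  x : ℚ
  x = mkℚ n d c
  open +-*-Solver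
  sum-same-denominator : (n ℤ.* + suc d ℤ.+ (+ q ℤ.* n) ℤ.* + suc d) ℤ.* + suc d
                       ≡ (+ suc q ℤ.* n) ℤ.* + (suc d Nat.* suc d)
  sum-same-denominator rewrite ℤₚ.pos-* (suc d) (suc d) | ℤₚ.pos-+ 1 q =
    solve 3 (λ n D Q → (n :* D :+ (Q :* n) :* D) :* D := ((con (+ 1) :+ Q) :* n) :* (D :* D))
      refl n (+ suc d) (+ q)

archimedean : ∀ δ → 0ℚ < δ → ∀ p → ∃[ q ] p ≤ q · δ
archimedean (mkℚ +[1+ a ] d c) _ (mkℚ n e _) =
  q , toℚᵘ-cancel-≤ (ℚᵘₚ.≤-respʳ-≃ (ℚᵘₚ.≃-sym (toℚᵘ-· q +[1+ a ] d c)) (ℚᵘ.*≤* (numerator-bound n)))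
  where
  -- q δ has numerator ∣n∣ (1 + a) over the denominator of δ, and that numerator is at least n.
  q : ℕ
  q = ℤ.∣ n ∣ Nat.* suc d
  numerator-bound : ∀ n → n ℤ.* + suc d ℤ.≤ (+ (ℤ.∣ n ∣ Nat.* suc d) ℤ.* +[1+ a ]) ℤ.* + suc e
  numerator-bound -[1+ _ ] = -≤+
  numerator-bound (+ x) rewrite sym (ℤₚ.pos-* x (suc d)) | sym (ℤₚ.pos-* (x Nat.* suc d) (suc a))
                              | sym (ℤₚ.pos-* (x Nat.* suc d Nat.* suc a) (suc e)) =
    +≤+ (Natₚ.≤-trans (Natₚ.m≤m*n (x Nat.* suc d) (suc a)) (Natₚ.m≤m*n _ (suc e)))
archimedean (mkℚ (+ 0) d c) (*<* (ℤ.+<+ ())) p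
archimedean (mkℚ -[1+ a ] d c) (*<* ()) p

1/-nonNeg : ∀ r .{{_ : NonZero r}} → 0ℚ ≤ r → NonNegative (1/ r)
1/-nonNeg (mkℚ +[1+ _ ] _ _) _ = _
1/-nonNeg (mkℚ -[1+ _ ] _ _) (*≤* ())

÷-monoˡ-≤ : ∀ {r} .{{_ : NonZero r}} → 0ℚ ≤ r → ∀ {p q} → p ≤ q → p ÷ r ≤ q ÷ r
÷-monoˡ-≤ {r} 0≤r = *-monoʳ-≤-nonNeg (1/ r) {{1/-nonNeg r 0≤r}}

r≤p⇒0≤p÷r-1 : ∀ {r} .{{_ : NonZero r}} → 0ℚ ≤ r → ∀ {p} → r ≤ p → 0ℚ ≤ p ÷ r - 1ℚ
r≤p⇒0≤p÷r-1 {r} 0≤r {p} r≤p = begin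
  0ℚ          ≡⟨ +-inverseʳ 1ℚ ⟨
  1ℚ - 1ℚ     ≡⟨ cong (_- 1ℚ) (*-inverseʳ r) ⟨
  r ÷ r - 1ℚ  ≤⟨ +-monoˡ-≤ (- 1ℚ) (÷-monoˡ-≤ 0≤r r≤p) ⟩
  p ÷ r - 1ℚ  ∎
  where open ≤-Reasoning

∣p÷r-1∣-mono-≤ : ∀ {r} .{{_ : NonZero r}} → 0ℚ ≤ r → ∀ {p q} → r ≤ p → p ≤ q →
                 ∣ p ÷ r - 1ℚ ∣ ≤ ∣ q ÷ r - 1ℚ ∣
∣p÷r-1∣-mono-≤ {r} 0≤r {p} {q} r≤p p≤q = begin
  ∣ p ÷ r - 1ℚ ∣  ≡⟨ 0≤p⇒∣p∣≡p (r≤p⇒0≤p÷r-1 0≤r r≤p) ⟩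
  p ÷ r - 1ℚ      ≤⟨ +-monoˡ-≤ (- 1ℚ) (÷-monoˡ-≤ 0≤r p≤q) ⟩
  q ÷ r - 1ℚ      ≡⟨ 0≤p⇒∣p∣≡p (r≤p⇒0≤p÷r-1 0≤r (≤-trans r≤p p≤q)) ⟨
  ∣ q ÷ r - 1ℚ ∣  ∎
  where open ≤-Reasoning

positive-lowerBound : (xs : List ℚ) → ∃[ δ ] 0ℚ < δ × (∀ {x} → x ∈ xs → 0ℚ < x → δ ≤ x)
positive-lowerBound [] = 1ℚ , positive⁻¹ 1ℚ , λ ()
positive-lowerBound (y ∷ xs) with positive-lowerBound xs | 0ℚ <? y
... | δ , 0<δ , δ≤ | no 0≮y = δ , 0<δ , λ { (here refl) 0<y → contradiction 0<y 0≮y ; (there x∈) → δ≤ x∈ }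
... | δ , 0<δ , δ≤ | yes 0<y with ≤-total y δ
...   | inj₁ y≤δ = y , 0<y , λ { (here refl) _ → ≤-refl ; (there x∈) 0<x → ≤-trans y≤δ (δ≤ x∈ 0<x) }
...   | inj₂ δ≤y = δ , 0<δ , λ { (here refl) _ → δ≤y ; (there x∈) → δ≤ x∈ }

lookup-injective : ∀ {A : Set} {xs : List A} → Unique xs → ∀ {i j} → lookup xs i ≡ lookup xs j → i ≡ j
lookup-injective {xs = _ ∷ _}  _ {zero}  {zero}  _  = refl
lookup-injective {xs = _ ∷ xs} u {zero}  {suc j} eq =
  contradiction (subst (_∈ xs) (sym eq) (∈-lookup j)) (Unique[x∷xs]⇒x∉xs u)
lookup-injective {xs = _ ∷ xs} u {suc i} {zero}  eq =
  contradiction (subst (_∈ xs) eq (∈-lookup i)) (Unique[x∷xs]⇒x∉xs u)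
lookup-injective {xs = _ ∷ _}  (_ ∷ u) {suc i} {suc j} eq = cong suc (lookup-injective u eq)

Unique⇒length≤ : ∀ {k} {xs : List (Fin k)} → Unique xs → length xs Nat.≤ k
Unique⇒length≤ u = Finₚ.injective⇒≤ (lookup-injective u)

module _ (K : WKS) where
  open WKS K renaming (trans to transitions)
  open import Data.List.Membership.DecPropositional (Finₚ._≟_ {k}) using (_∈?_)

  infixr 5 _++_
  _++_ : ∀ {t a u m n} → Path K t a m → Path K a u n → Path K t u (m Nat.+ n)
  done ++ ρ = ρ
  step v e α ++ ρ = step v e (α ++ ρ)

  weight-++ : ∀ {t a u m n} (α : Path K t a m) (ρ : Path K a u n) →
              weight K (α ++ ρ) ≡ weight K α + weight K ρ
  weight-++ done ρ = sym (+-identityˡ (weight K ρ))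
  weight-++ (step v e α) ρ =
    trans (cong (_+_ v) (weight-++ α ρ)) (sym (+-assoc v (weight K α) (weight K ρ)))

  splitAt : ∀ m {n t u} (π : Path K t u (m Nat.+ n)) →
            ∃[ a ] Σ (Path K t a m) λ α → Σ (Path K a u n) λ ρ → α ++ ρ ≡ π
  splitAt zero π = _ , done , π , refl
  splitAt (suc m) (step v e π) with splitAt m π
  ... | a , α , ρ , refl = a , step v e α , ρ , refl

  inner-step-⊆ : ∀ {t t₁ u n v} (e : (t , v , t₁) ∈ transitions) (π : Path K t₁ u n) →
                 inner K π ⊆ inner K (step v e π)
  inner-step-⊆ e done ()
  inner-step-⊆ e (step _ _ _) = there

  -- Without m ≤ n, a nonempty σ against an empty ρ would add the junction state a.
  inner-++⁺ʳ : ∀ {t a u l m n} (α : Path K t a l) (σ : Path K a u m) (ρ : Path K a u n) →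
               m Nat.≤ n → inner K σ ⊆ inner K ρ → inner K (α ++ σ) ⊆ inner K (α ++ ρ)
  inner-++⁺ʳ done σ ρ _ σ⊆ρ = σ⊆ρ
  inner-++⁺ʳ (step _ _ done) done ρ _ _ ()
  inner-++⁺ʳ (step _ _ done) (step _ _ _) done () _
  inner-++⁺ʳ (step _ _ done) (step _ _ _) (step _ _ _) _ _ (here x≡) = here x≡
  inner-++⁺ʳ (step _ _ done) (step _ _ _) (step _ _ _) _ σ⊆ρ (there x∈) = there (σ⊆ρ x∈)
  inner-++⁺ʳ (step _ _ (step _ _ _)) σ ρ _ _ (here x≡) = here x≡
  inner-++⁺ʳ (step _ _ α@(step _ _ _)) σ ρ m≤n σ⊆ρ (there x∈) = there (inner-++⁺ʳ α σ ρ m≤n σ⊆ρ x∈)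

  weight-nonNeg : ∀ {t u n} (π : Path K t u n) → 0ℚ ≤ weight K π
  weight-nonNeg done = ≤-refl
  weight-nonNeg (step v e π) = +-mono-≤ (All.lookup nonneg e) (weight-nonNeg π)

  states : ∀ {t u n} → Path K t u n → List (Fin k)
  states {t} done = t ∷ []
  states {t} (step _ _ π) = t ∷ states π

  length-states : ∀ {t u n} (π : Path K t u n) → length (states π) ≡ suc n
  length-states done = refl
  length-states (step _ _ π) = cong suc (length-states π)

  simple⇒length< : ∀ {t u n} (π : Path K t u n) → Unique (states π) → n Nat.< k
  simple⇒length< π simple = subst (Nat._≤ k) (length-states π) (Unique⇒length≤ simple)

  record Visit {a u m} (x : Fin k) (π : Path K a u m) : Set where
    field
      {l₁ l₂}       : ℕ
      prefix        : Path K a x l₁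
      suffix        : Path K x u l₂
      weight-sum    : weight K prefix + weight K suffix ≡ weight K π
      suffix-≤      : l₂ Nat.≤ m
      suffix-simple : Unique (states suffix)
      suffix-inner  : inner K suffix ⊆ inner K π

  visit : ∀ {a u m x} (π : Path K a u m) → x ∈ states π → Unique (states π) → Visit x π
  visit done (here refl) simple = record
    { prefix = done ; suffix = done ; weight-sum = +-identityˡ 0ℚ
    ; suffix-≤ = z≤n ; suffix-simple = simple ; suffix-inner = λ x∈ → x∈ }
  visit π@(step _ _ _) (here refl) simple = record
    { prefix = done ; suffix = π ; weight-sum = +-identityˡ (weight K π)
    ; suffix-≤ = Natₚ.≤-refl ; suffix-simple = simple ; suffix-inner = λ x∈ → x∈ }
  visit (step v e π) (there x∈) (_ ∷ simple) = record
    { prefix = step v e V.prefix ; suffix = V.suffix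
    ; weight-sum = trans (+-assoc v (weight K V.prefix) (weight K V.suffix)) (cong (_+_ v) V.weight-sum)
    ; suffix-≤ = Natₚ.m≤n⇒m≤1+n V.suffix-≤ ; suffix-simple = V.suffix-simple
    ; suffix-inner = inner-step-⊆ e π ∘ V.suffix-inner }
    where module V = Visit (visit π x∈ simple)

  transition-weights : List ℚ
  transition-weights = map (proj₁ ∘ proj₂) transitions

  δ : ℚ
  δ = proj₁ (positive-lowerBound transition-weights)

  δ-positive : 0ℚ < δ
  δ-positive = proj₁ (proj₂ (positive-lowerBound transition-weights))

  δ≤positive-transition : ∀ {t v u} → (t , v , u) ∈ transitions → 0ℚ < v → δ ≤ v
  δ≤positive-transition e = proj₂ (proj₂ (positive-lowerBound transition-weights)) (∈-map⁺ (proj₁ ∘ proj₂) e)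

  δ≤positive-weight : ∀ {t u n} (π : Path K t u n) → 0ℚ < weight K π → δ ≤ weight K π
  δ≤positive-weight done 0<0 = contradiction 0<0 (<-irrefl refl)
  δ≤positive-weight (step v e π) 0<w with 0ℚ <? v
  ... | yes 0<v = begin
    δ              ≤⟨ δ≤positive-transition e 0<v ⟩
    v              ≡⟨ +-identityʳ v ⟨
    v + 0ℚ         ≤⟨ +-monoʳ-≤ v (weight-nonNeg π) ⟩
    v + weight K π ∎
    where open ≤-Reasoning
  ... | no 0≮v = begin
    δ              ≤⟨ δ≤positive-weight π (<-≤-trans 0<w (≤-reflexive v+w≡w)) ⟩
    weight K π     ≡⟨ v+w≡w ⟨
    v + weight K π ∎
    where
    open ≤-Reasoning
    v+w≡w : v + weight K π ≡ weight K π
    v+w≡w = trans (cong (_+ weight K π) (≤-antisym (≮⇒≥ 0≮v) (All.lookup nonneg e))) (+-identityˡ (weight K π))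

  record LoopErasure {a u n} (π : Path K a u n) : Set where
    field
      {m}              : ℕ
      path             : Path K a u m
      simple           : Unique (states path)
      shorter          : m Nat.≤ n
      lighter          : weight K path ≤ weight K π
      strictly-lighter : m Nat.< n → weight K path < weight K π
      inner-⊆          : inner K path ⊆ inner K π

  module _ (noZeroCycles : NoZeroCycles K) where

    eraseLoops : ∀ {a u n} (π : Path K a u n) → LoopErasure π
    eraseLoops done = record
      { path = done ; simple = All.[] ∷ [] ; shorter = z≤n ; lighter = ≤-refl
      ; strictly-lighter = λ () ; inner-⊆ = λ x∈ → x∈ }
    eraseLoops (step {t} v e π) with eraseLoops π
    ... | E with t ∈? states (LoopErasure.path E)
    ... | no t∉ = record
      { path = step v e E.path
      ; simple = ¬Any⇒All¬ _ t∉ ∷ E.simple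
      ; shorter = s≤s E.shorter
      ; lighter = +-monoʳ-≤ v E.lighter
      ; strictly-lighter = λ { (s≤s m<n) → +-monoʳ-< v (E.strictly-lighter m<n) }
      ; inner-⊆ = inner-++⁺ʳ (step v e done) E.path π E.shorter E.inner-⊆ }
      where module E = LoopErasure E
    -- t recurs on the erased tail: cut out the cycle through t, whose weight is positive.
    ... | yes t∈ = record
      { path = V.suffix
      ; simple = V.suffix-simple
      ; shorter = Natₚ.m≤n⇒m≤1+n (Natₚ.≤-trans V.suffix-≤ E.shorter)
      ; lighter = <⇒≤ cycle-removed
      ; strictly-lighter = λ _ → cycle-removed
      ; inner-⊆ = inner-step-⊆ e π ∘ E.inner-⊆ ∘ V.suffix-inner }
      where
      module E = LoopErasure E
      module V = Visit (visit E.path t∈ E.simple)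
      cycle-removed : weight K V.suffix < v + weight K π
      cycle-removed = begin-strict
        weight K V.suffix                            ≡⟨ +-identityˡ (weight K V.suffix) ⟨
        0ℚ + weight K V.suffix                       <⟨ +-monoˡ-< (weight K V.suffix) (noZeroCycles (step v e V.prefix)) ⟩
        (v + weight K V.prefix) + weight K V.suffix  ≡⟨ +-assoc v (weight K V.prefix) (weight K V.suffix) ⟩
        v + (weight K V.prefix + weight K V.suffix)  ≡⟨ cong (_+_ v) V.weight-sum ⟩
        v + weight K E.path                          ≤⟨ +-monoʳ-≤ v E.lighter ⟩
        v + weight K π                               ∎
        where open ≤-Reasoning

    long-path-positive : ∀ {a b n} (π : Path K a b n) → k Nat.≤ n → 0ℚ < weight K π
    long-path-positive π k≤n = ≤-<-trans (weight-nonNeg E.path)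
      (E.strictly-lighter (Natₚ.<-≤-trans (simple⇒length< E.path E.simple) k≤n))
      where module E = LoopErasure (eraseLoops π)

    blocks-weight : ∀ q {a b} (π : Path K a b (q Nat.* k)) → q · δ ≤ weight K π
    blocks-weight zero π = weight-nonNeg π
    blocks-weight (suc q) π with splitAt k π
    ... | _ , α , ρ , refl = begin
      δ + q · δ               ≤⟨ +-mono-≤ (δ≤positive-weight α (long-path-positive α Natₚ.≤-refl))
                                           (blocks-weight q ρ) ⟩
      weight K α + weight K ρ ≡⟨ weight-++ α ρ ⟨
      weight K (α ++ ρ)       ∎
      where open ≤-Reasoning

    record Shortcut {t u n} (l : ℕ) (π : Path K t u n) : Set where
      field
        {a}            : Fin k
        {m}            : ℕ
        prefix         : Path K t a l
        path           : Path K t u (l Nat.+ m)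
        tail<k         : m Nat.< k
        prefix-lighter : weight K prefix ≤ weight K path
        lighter        : weight K path ≤ weight K π
        inner-⊆        : inner K path ⊆ inner K π

    shortcut-after : ∀ l {t u n} (π : Path K t u n) → l Nat.≤ n → Shortcut l π
    shortcut-after l π l≤n with Natₚ.m≤n⇒∃[o]m+o≡n l≤n
    ... | _ , refl with splitAt l π
    ... | _ , α , ρ , refl = record
      { prefix = α ; path = α ++ E.path ; tail<k = simple⇒length< E.path E.simple
      ; prefix-lighter = α-lighter ; lighter = tail-lighter
      ; inner-⊆ = inner-++⁺ʳ α E.path ρ E.shorter E.inner-⊆ }
      where
      module E = LoopErasure (eraseLoops ρ)
      open ≤-Reasoning
      α-lighter : weight K α ≤ weight K (α ++ E.path)
      α-lighter = begin
        weight K α                   ≡⟨ +-identityʳ (weight K α) ⟨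
        weight K α + 0ℚ              ≤⟨ +-monoʳ-≤ (weight K α) (weight-nonNeg E.path) ⟩
        weight K α + weight K E.path ≡⟨ weight-++ α E.path ⟨
        weight K (α ++ E.path)       ∎
      tail-lighter : weight K (α ++ E.path) ≤ weight K (α ++ ρ)
      tail-lighter = begin
        weight K (α ++ E.path)       ≡⟨ weight-++ α E.path ⟩
        weight K α + weight K E.path ≤⟨ +-monoʳ-≤ (weight K α) E.lighter ⟩
        weight K α + weight K ρ      ≡⟨ weight-++ α ρ ⟨
        weight K (α ++ ρ)            ∎

lemma2 : (K : WKS) → NoZeroCycles K →
         (s s' : Fin (WKS.k K)) (w : ℚ) → (s , w , s') ∈ WKS.trans K →
         .{{_ : NonZero w}} → (t : Fin (WKS.k K)) →
         ∃[ N ] (∀ {u : Fin (WKS.k K)} {n : ℕ} (π : Path K t u n) → N Nat.≤ n →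
           ∃[ m ] Σ (Path K t u m) (λ π* →
             m Nat.≤ N ×
             ∣ (weight K π* ÷ w) - 1ℚ ∣ ≤ ∣ (weight K π ÷ w) - 1ℚ ∣ ×
             (∀ x → x ∈ inner K π* → x ∈ inner K π)))
lemma2 K noZeroCycles s s' w e t = q Nat.* k Nat.+ k , λ π N≤n →
  let open Shortcut (shortcut-after K noZeroCycles (q Nat.* k) π (Natₚ.≤-trans (Natₚ.m≤m+n _ k) N≤n))
      w≤path : w ≤ weight K path
      w≤path = ≤-trans w≤q·δ (≤-trans (blocks-weight K noZeroCycles q prefix) prefix-lighter)
  in _ , path , Natₚ.+-monoʳ-≤ (q Nat.* k) (Natₚ.<⇒≤ tail<k) ,
     ∣p÷r-1∣-mono-≤ (All.lookup nonneg e) w≤path lighter , λ _ → inner-⊆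
  where
  open WKS K using (k; nonneg)
  q : ℕ
  q = proj₁ (archimedean (δ K) (δ-positive K) w)
  w≤q·δ : w ≤ q · δ K
  w≤q·δ = proj₂ (archimedean (δ K) (δ-positive K) w)
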